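{- Let $p$ be a prime with $p-1=2^iq_1^{j_1}q_2^{j_2}$, where $q_1\neq q_2$ are odd primes and $i,j_1,j_2\ge 1$. The map $f:V\to V_1$, $f(\mathcal{M}(g))=\mathcal{NI}(h)$ for any $h\in\mathcal{M}(g)$, is a bijection.
   Context: $\mathcal{G}$ is the set of generators of $\mathbb{Z}_p^*$, $\mathcal{R}$ the set of quadratic residues in $\mathbb{Z}_p^*$, $\mathcal{NG}$ the set of quadratic non-residues that are not generators. For $g\in\mathcal{G}$: $\mathcal{R}_g=\{r\in\mathcal{R}: gr\in\mathcal{G}\}$, $\bar{\mathcal{R}}_g=\{r\in\mathcal{R}: gr\in\mathcal{NG}\}$, $\mathcal{I}(g)=\mathcal{R}_g\cap\mathcal{R}_{g^{ -1}}$, $\mathcal{NI}(g)=\bar{\mathcal{R}}_g\cap\bar{\mathcal{R}}_{g^{ -1}}$, $\mathcal{M}(g)=\mathcal{G}\setminus\{gr,\ g^{ -1}r : r\in\mathcal{I}(g)\}$ (products mod $p$). $V=\{\mathcal{M}(g): g\in\mathcal{G}\}$ and $V_1=\{\mathcal{NI}(g): g\in\mathcal{G}\}$. The value $\mathcal{NI}(h)$ is the same for all $h\in\mathcal{M}(g)$ and depends only on the set $\mathcal{M}(g)$, so $f$ is well defined. -}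

module Defs where

open import Data.Nat using (ℕ; _*_; _^_; NonZero)
open import Data.Nat.DivMod using (_%_; m%n<n)
open import Data.Fin using (Fin; toℕ; fromℕ<)
open import Data.Product using (_×_; ∃-syntax)
open import Data.Sum using (_⊎_)
open import Relation.Nullary using (¬_)
open import Relation.Binary.PropositionalEquality using (_≡_; _≢_)

-- Everything is relative to a modulus p; elements of ℤ_p are Fin p,
-- ℤ_p^* consists of the nonzero ones.  Subsets are predicates Fin p → Set.
module _ (p : ℕ) .{{_ : NonZero p}} where

  Elt : Set
  Elt = Fin p

  mul : Elt → Elt → Elt
  mul x y = fromℕ< (m%n<n (toℕ x * toℕ y) p)

  Unit : Elt → Set
  Unit x = toℕ x ≢ 0

  IsInv : Elt → Elt → Set
  IsInv g y = toℕ (mul g y) ≡ 1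

  IsGen : Elt → Set
  IsGen g = Unit g × (∀ x → Unit x → ∃[ k ] (toℕ g ^ k) % p ≡ toℕ x)

  IsQR : Elt → Set
  IsQR r = Unit r × ∃[ x ] mul x x ≡ r

  IsNG : Elt → Set
  IsNG x = Unit x × ¬ IsQR x × ¬ IsGen x

  Rg : Elt → Elt → Set
  Rg g r = IsQR r × IsGen (mul g r)

  Rbar : Elt → Elt → Set
  Rbar g r = IsQR r × IsNG (mul g r)

  I : Elt → Elt → Set
  I g r = Rg g r × ∃[ y ] (IsInv g y × Rg y r)

  NI : Elt → Elt → Set
  NI g r = Rbar g r × ∃[ y ] (IsInv g y × Rbar y r)

  M : Elt → Elt → Set
  M g x = IsGen x × ¬ (∃[ r ] (I g r × (x ≡ mul g r ⊎ ∃[ y ] (IsInv g y × x ≡ mul y r))))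

  _≐_ : (Elt → Set) → (Elt → Set) → Set
  A ≐ B = ∀ x → (A x → B x) × (B x → A x)

  -- f : V → V₁, f(ℳ(g)) = 𝒩ℐ(h) for h ∈ ℳ(g), is a well-defined bijection.
  -- V = { ℳ(g) : g ∈ 𝒢 },  V₁ = { 𝒩ℐ(g) : g ∈ 𝒢 }, sets compared by ≐.
  record fIsBijection : Set where
    field
      -- well-definedness: ℳ(g) is nonempty and 𝒩ℐ is constant on it
      nonempty : ∀ g → IsGen g → ∃[ h ] M g h
      constant : ∀ g → IsGen g → ∀ h h' → M g h → M g h' → NI h ≐ NI h'
      injective : ∀ g g' → IsGen g → IsGen g' → ∀ h h' → M g h → M g' h' →
                  NI h ≐ NI h' → M g ≐ M g'
      surjective : ∀ g → IsGen g → ∃[ g' ] (IsGen g' × ∃[ h ] (M g' h × NI h ≐ NI g))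

module Submission where

-- Write the units of ℤ_p as powers γ^a of a fixed generator γ, with a ∈ ℤ taken modulo
-- n = p − 1. Since the primes dividing n are 2, q₁ and q₂, γ^a is a generator iff a is odd
-- and prime to q₁q₂, a quadratic residue iff a is even, and in 𝒩𝒢 iff a is odd and divisible
-- by q₁ or q₂. Call x twisted to y if x ≡ εy (mod q₁) and x ≡ −εy (mod q₂) for a sign ε.
-- Unwinding the definitions, ℳ(γ^u) consists of the γ^v with v odd and twisted to 2u, and
-- 𝒩ℐ(γ^v) of the γ^e with e even and twisted to v. Two twists compose to congruence up to a
-- common sign modulo q₁ and q₂, so 𝒩ℐ is constant on ℳ(γ^u), and both ℳ(γ^u) and f(ℳ(γ^u))
-- correspond to the class of 2u under this congruence. The Chinese remainder theorem supplies
-- exponents with prescribed residues and parity, and 2 is invertible modulo q₁q₂; this gives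
-- non-emptiness, injectivity and surjectivity.

open import Defs

import Algebra.Properties.CommutativeSemigroup as CommutativeSemigroupProperties
open import Data.Empty using (⊥-elim)
open import Data.Fin.Base as Fin using (Fin; toℕ; fromℕ<)
import Data.Fin.Properties as Fin
open import Data.Integer.Base as ℤ using (ℤ; +_; 0ℤ; 1ℤ; _%ℕ_)
open import Data.Integer.Coprimality using (Coprime)
open import Data.Integer.DivMod using (a≡a%ℕn+[a/ℕn]*n; n%ℕd<d)
open import Data.Integer.Divisibility.Signed
  using (_∣_; _∣?_; divides; ∣ᵤ⇒∣; ∣⇒∣ᵤ; ∣-trans; ∣m∣n⇒∣m+n; ∣m∣n⇒∣m-n; ∣m⇒∣-m; ∣n⇒∣m*n; ∣m+n∣n⇒∣m)
import Data.Integer.Properties as ℤ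
open import Data.Integer.Tactic.RingSolver using (solve-∀)
open import Data.Nat.Base as ℕ using (ℕ; zero; suc; NonZero)
import Data.Nat.Coprimality as ℕ
import Data.Nat.DivMod as ℕ
import Data.Nat.Divisibility as ℕ
open import Data.Nat.GCD using (module Bézout)
open import Data.Nat.Primality
  using (Prime; euclidsLemma; ¬prime[0]; ¬prime[1]; prime[2]; prime⇒nonTrivial; prime⇒irreducible)
import Data.Nat.Properties as ℕ
open import Data.Product using (_×_; _,_; proj₁; proj₂; ∃-syntax)
open import Data.Product.Function.NonDependent.Propositional using (_×-⇔_)
open import Data.Sign.Base as Sign using (Sign)
import Data.Sign.Properties as Signₚ
open import Data.Sum using (_⊎_; inj₁; inj₂; [_,_]′)
open import Data.Sum.Function.Propositional using (_⊎-⇔_)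
open import Function.Bundles using (_⇔_; mk⇔; Equivalence)
open import Function.Construct.Composition using (_⇔-∘_)
open import Function.Construct.Identity using (⇔-id)
open import Level using (0ℓ)
open import Relation.Binary.Bundles using (Setoid)
open import Relation.Binary.Definitions using (tri<; tri≈; tri>)
open import Relation.Binary.PropositionalEquality
import Relation.Binary.Reasoning.Setoid as SetoidReasoning
open import Relation.Nullary using (¬_; yes; no)

module _ where
  open import Data.Integer.Base using (_+_; _-_; -_; _*_)

  infix 4 _≡_mod_

  record _≡_mod_ (x y : ℤ) (d : ℕ) : Set where
    constructor congruent
    field divides-difference : + d ∣ x - y

  open _≡_mod_ public

  module _ {d : ℕ} where

    ≡-reflexive : ∀ {x y} → x ≡ y → x ≡ y mod d
    ≡-reflexive {x} refl = congruent (divides 0ℤ (ℤ.+-inverseʳ x))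

    ≡-refl : ∀ {x} → x ≡ x mod d
    ≡-refl = ≡-reflexive refl

    ≡-sym : ∀ {x y} → x ≡ y mod d → y ≡ x mod d
    ≡-sym {x} {y} (congruent x≡y) = congruent (subst (_ ∣_) (minus-anti x y) (∣m⇒∣-m x≡y))
      where
      minus-anti : ∀ x y → - (x - y) ≡ y - x
      minus-anti = solve-∀

    ≡-trans : ∀ {x y z} → x ≡ y mod d → y ≡ z mod d → x ≡ z mod d
    ≡-trans {x} {y} {z} (congruent x≡y) (congruent y≡z) =
      congruent (subst (_ ∣_) (ℤ.+-minus-telescope x y z) (∣m∣n⇒∣m+n x≡y y≡z))

    -‿cong : ∀ {x y} → x ≡ y mod d → - x ≡ - y mod d
    -‿cong {x} {y} (congruent x≡y) = congruent (subst (_ ∣_) (neg-minus x y) (∣m⇒∣-m x≡y))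
      where
      neg-minus : ∀ x y → - (x - y) ≡ - x - - y
      neg-minus = solve-∀

    +-cong : ∀ {x y u v} → x ≡ y mod d → u ≡ v mod d → x + u ≡ y + v mod d
    +-cong {x} {y} {u} {v} (congruent x≡y) (congruent u≡v) =
      congruent (subst (_ ∣_) (interchange x y u v) (∣m∣n⇒∣m+n x≡y u≡v))
      where
      interchange : ∀ x y u v → (x - y) + (u - v) ≡ (x + u) - (y + v)
      interchange = solve-∀

    *-congˡ : ∀ c {x y} → x ≡ y mod d → c * x ≡ c * y mod d
    *-congˡ c {x} {y} (congruent x≡y) = congruent (subst (_ ∣_) (distrib c x y) (∣n⇒∣m*n c x≡y))
      where
      distrib : ∀ c x y → c * (x - y) ≡ c * x - c * y
      distrib = solve-∀

    ≡-mod-∣ : ∀ {m x y} → d ℕ.∣ m → x ≡ y mod m → x ≡ y mod d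
    ≡-mod-∣ d∣m (congruent m∣x-y) = congruent (∣-trans (∣ᵤ⇒∣ d∣m) m∣x-y)

    ∣-respects-≡-mod : ∀ {x y} → x ≡ y mod d → + d ∣ x → + d ∣ y
    ∣-respects-≡-mod {x} {y} (congruent d∣x-y) d∣x = subst (_ ∣_) (cancel x y) (∣m∣n⇒∣m-n d∣x d∣x-y)
      where
      cancel : ∀ x y → x - (x - y) ≡ y
      cancel = solve-∀

    ∣⇔≡-mod : ∀ {a x y} → a ≡ x - y → (+ d ∣ a) ⇔ (x ≡ y mod d)
    ∣⇔≡-mod a≡x-y = mk⇔ (λ d∣a → congruent (subst (_ ∣_) a≡x-y d∣a))
                        (λ x≡y → subst (_ ∣_) (sym a≡x-y) (divides-difference x≡y))

    ≡-mod-setoid : Setoid 0ℓ 0ℓ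
    ≡-mod-setoid = record
      { Carrier       = ℤ
      ; _≈_           = λ x y → x ≡ y mod d
      ; isEquivalence = record { refl = ≡-refl ; sym = ≡-sym ; trans = ≡-trans }
      }

    module ≡-mod-Reasoning = SetoidReasoning ≡-mod-setoid

    module _ .{{_ : NonZero d}} where

      ≡-%ℕ : ∀ a → a ≡ + (a %ℕ d) mod d
      ≡-%ℕ a = congruent (divides (a ℤ./ℕ d) (begin
        a - + (a %ℕ d)                            ≡⟨ cong (_- + (a %ℕ d)) (a≡a%ℕn+[a/ℕn]*n a d) ⟩
        + (a %ℕ d) + a ℤ./ℕ d * + d - + (a %ℕ d)  ≡⟨ cancel (+ (a %ℕ d)) (a ℤ./ℕ d * + d) ⟩
        a ℤ./ℕ d * + d                            ∎))
        where
        open ≡-Reasoning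
        cancel : ∀ r s → r + s - r ≡ s
        cancel = solve-∀

      multiple-<⇒≡0 : ∀ {k} → k ℕ.< d → d ℕ.∣ k → k ≡ 0
      multiple-<⇒≡0 {zero}  _   _   = refl
      multiple-<⇒≡0 {suc k} k<d d∣k = ⊥-elim (ℕ.>⇒∤ k<d d∣k)

      residue-unique≤ : ∀ {r s} → r ℕ.≤ s → s ℕ.< d → + s ≡ + r mod d → r ≡ s
      residue-unique≤ {r} {s} r≤s s<d (congruent s≡r) =
        ℕ.≤-antisym r≤s (ℕ.m∸n≡0⇒m≤n (multiple-<⇒≡0 (ℕ.≤-<-trans (ℕ.m∸n≤m s r) s<d) d∣s∸r))
        where
        d∣s∸r : d ℕ.∣ s ℕ.∸ r
        d∣s∸r = subst (λ z → d ℕ.∣ ℤ.∣ z ∣) (trans (ℤ.m-n≡m⊖n s r) (ℤ.⊖-≥ r≤s)) (∣⇒∣ᵤ s≡r)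

      residue-unique : ∀ {r s} → r ℕ.< d → s ℕ.< d → + r ≡ + s mod d → r ≡ s
      residue-unique {r} {s} r<d s<d r≡s with ℕ.≤-total r s
      ... | inj₁ r≤s = residue-unique≤ r≤s s<d (≡-sym r≡s)
      ... | inj₂ s≤r = sym (residue-unique≤ s≤r r<d r≡s)

      %ℕ-cong : ∀ {a b} → a ≡ b mod d → a %ℕ d ≡ b %ℕ d
      %ℕ-cong {a} {b} a≡b = residue-unique (n%ℕd<d a d) (n%ℕd<d b d)
        (≡-trans (≡-sym (≡-%ℕ a)) (≡-trans a≡b (≡-%ℕ b)))

      %≡%⇒≡-mod : ∀ {m n} → m ℕ.% d ≡ n ℕ.% d → + m ≡ + n mod d
      %≡%⇒≡-mod {m} {n} m≡n = ≡-trans (≡-%ℕ (+ m)) (≡-trans (≡-reflexive (cong +_ m≡n)) (≡-sym (≡-%ℕ (+ n))))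


  infixr 8 _∙_

  _∙_ : Sign → ℤ → ℤ
  Sign.+ ∙ x = x
  Sign.- ∙ x = - x

  ∙-∙ : ∀ s t x → s ∙ (t ∙ x) ≡ (s Sign.* t) ∙ x
  ∙-∙ Sign.+ t        x = refl
  ∙-∙ Sign.- Sign.+ x = refl
  ∙-∙ Sign.- Sign.- x = ℤ.neg-involutive x

  *-∙ : ∀ c s x → c * (s ∙ x) ≡ s ∙ (c * x)
  *-∙ c Sign.+ x = refl
  *-∙ c Sign.- x = sym (ℤ.neg-distribʳ-* c x)

  module _ {d : ℕ} where

    ∙-cong : ∀ s {x y} → x ≡ y mod d → s ∙ x ≡ s ∙ y mod d
    ∙-cong Sign.+ x≡y = x≡y
    ∙-cong Sign.- x≡y = -‿cong x≡y

    ∙-trans : ∀ {x} s {y} t z → x ≡ s ∙ y mod d → y ≡ t ∙ z mod d → x ≡ (s Sign.* t) ∙ z mod d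
    ∙-trans s t z x≡sy y≡tz = ≡-trans x≡sy (≡-trans (∙-cong s y≡tz) (≡-reflexive (∙-∙ s t z)))

    ∙-sym : ∀ {x} s y → x ≡ s ∙ y mod d → y ≡ s ∙ x mod d
    ∙-sym s y x≡sy = ≡-sym (≡-trans (∙-cong s x≡sy) (≡-reflexive (trans (∙-∙ s s y) (cong (_∙ y) (Signₚ.s*s≡+ s)))))

    ≡-±⇒∣2* : ∀ {x y} → x ≡ y mod d → x ≡ - y mod d → + d ∣ + 2 * y
    ≡-±⇒∣2* {x} {y} x≡y x≡-y = subst (_ ∣_) (double y) (divides-difference (≡-trans (≡-sym x≡y) x≡-y))
      where
      double : ∀ y → y - - y ≡ + 2 * y
      double = solve-∀

    ∙-∤ : ∀ {x} s y → x ≡ s ∙ y mod d → ¬ (+ d ∣ y) → ¬ (+ d ∣ x)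
    ∙-∤ Sign.+ y x≡y d∤y d∣x = d∤y (∣-respects-≡-mod x≡y d∣x)
    ∙-∤ Sign.- y x≡-y d∤y d∣x = d∤y (subst (_ ∣_) (ℤ.neg-involutive y) (∣m⇒∣-m (∣-respects-≡-mod x≡-y d∣x)))

  euclidsLemmaℤ : ∀ {p} → Prime p → ∀ x y → + p ∣ x * y → + p ∣ x ⊎ + p ∣ y
  euclidsLemmaℤ p-prime x y p∣xy
    with euclidsLemma ℤ.∣ x ∣ ℤ.∣ y ∣ p-prime (subst (_ ℕ.∣_) (ℤ.abs-* x y) (∣⇒∣ᵤ p∣xy))
  ... | inj₁ p∣x = inj₁ (∣ᵤ⇒∣ p∣x)
  ... | inj₂ p∣y = inj₂ (∣ᵤ⇒∣ p∣y)

  abs-absorb : ∀ u a → ∃[ v ] (v * a ≡ u * + ℤ.∣ a ∣)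
  abs-absorb u a with ℤ.+∣i∣≡i⊎+∣i∣≡-i a
  ... | inj₁ ∣a∣≡a  = u , cong (u *_) (sym ∣a∣≡a)
  ... | inj₂ ∣a∣≡-a = - u , (begin
    - u * a   ≡⟨ ℤ.neg-distribˡ-* u a ⟨
    - (u * a) ≡⟨ ℤ.neg-distribʳ-* u a ⟩
    u * - a   ≡⟨ cong (u *_) ∣a∣≡-a ⟨
    u * + ℤ.∣ a ∣ ∎)
    where open ≡-Reasoning

  private
    1+yn≡xm : ∀ x y m n → 1 ℕ.+ y ℕ.* n ≡ x ℕ.* m → 1ℤ + + y * + n ≡ + x * + m
    1+yn≡xm x y m n eq = begin
      1ℤ + + y * + n   ≡⟨ cong (_+_ 1ℤ) (ℤ.pos-* y n) ⟨
      + (1 ℕ.+ y ℕ.* n) ≡⟨ cong +_ eq ⟩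
      + (x ℕ.* m)      ≡⟨ ℤ.pos-* x m ⟩
      + x * + m        ∎
      where open ≡-Reasoning

  bézoutℕ : ∀ {m n} → ℕ.Coprime m n → ∃[ u ] ∃[ v ] (u * + m + v * + n ≡ 1ℤ)
  bézoutℕ {m} {n} m⊥n with ℕ.coprime-Bézout m⊥n
  ... | Bézout.+- x y eq = + x , - + y , (begin
    + x * + m + - + y * + n         ≡⟨ cong (_+ - + y * + n) (1+yn≡xm x y m n eq) ⟨
    1ℤ + + y * + n + - + y * + n    ≡⟨ cancel (+ y) (+ n) ⟩
    1ℤ                              ∎)
    where
    open ≡-Reasoning
    cancel : ∀ y n → 1ℤ + y * n + - y * n ≡ 1ℤ
    cancel = solve-∀
  ... | Bézout.-+ x y eq = - + x , + y , (begin
    - + x * + m + + y * + n         ≡⟨ cong (_+_ (- + x * + m)) (1+yn≡xm y x n m eq) ⟨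
    - + x * + m + (1ℤ + + x * + m)  ≡⟨ cancel (+ x) (+ m) ⟩
    1ℤ                              ∎)
    where
    open ≡-Reasoning
    cancel : ∀ x m → - x * m + (1ℤ + x * m) ≡ 1ℤ
    cancel = solve-∀

  bézout : ∀ {a b} → Coprime a b → ∃[ u ] ∃[ v ] (u * a + v * b ≡ 1ℤ)
  bézout {a} {b} a⊥b with bézoutℕ a⊥b
  ... | u , v , eq with abs-absorb u a | abs-absorb v b
  ... | u′ , u′a≡u∣a∣ | v′ , v′b≡v∣b∣ = u′ , v′ , trans (cong₂ _+_ u′a≡u∣a∣ v′b≡v∣b∣) eq

  invertible-mod : ∀ a {n} → Coprime a (+ n) → ∃[ s ] (s * a ≡ 1ℤ mod n)
  invertible-mod a {n} a⊥n with bézout {a} a⊥n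
  ... | u , v , ua+vn≡1 = u , congruent (divides (- v) (begin
    u * a - 1ℤ                 ≡⟨ cong (λ t → u * a - t) ua+vn≡1 ⟨
    u * a - (u * a + v * + n)  ≡⟨ cancel (u * a) v (+ n) ⟩
    - v * + n                  ∎))
    where
    open ≡-Reasoning
    cancel : ∀ x v n → x - (x + v * n) ≡ - v * n
    cancel = solve-∀

  crt : ∀ {m₁ m₂} → ℕ.Coprime m₁ m₂ → ∀ a b → ∃[ z ] (z ≡ a mod m₁ × z ≡ b mod m₂)
  crt {m₁} {m₂} m₁⊥m₂ a b with bézout m₁⊥m₂
  ... | u , v , um₁+vm₂≡1 = z , congruent (divides ((b - a) * u) (begin
    z - a                              ≡⟨ cong (_-_ z) (ℤ.*-identityʳ a) ⟨
    z - a * 1ℤ                         ≡⟨ cong (λ t → z - a * t) um₁+vm₂≡1 ⟨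
    z - a * (u * + m₁ + v * + m₂)      ≡⟨ diff₁ a b u v (+ m₁) (+ m₂) ⟩
    (b - a) * u * + m₁                 ∎))
                            , congruent (divides ((a - b) * v) (begin
    z - b                              ≡⟨ cong (_-_ z) (ℤ.*-identityʳ b) ⟨
    z - b * 1ℤ                         ≡⟨ cong (λ t → z - b * t) um₁+vm₂≡1 ⟨
    z - b * (u * + m₁ + v * + m₂)      ≡⟨ diff₂ a b u v (+ m₁) (+ m₂) ⟩
    (a - b) * v * + m₂                 ∎))
    where
    open ≡-Reasoning
    z = a * (v * + m₂) + b * (u * + m₁)
    diff₁ : ∀ a b u v m₁ m₂ → a * (v * m₂) + b * (u * m₁) - a * (u * m₁ + v * m₂) ≡ (b - a) * u * m₁
    diff₁ = solve-∀
    diff₂ : ∀ a b u v m₁ m₂ → a * (v * m₂) + b * (u * m₁) - b * (u * m₁ + v * m₂) ≡ (a - b) * v * m₂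
    diff₂ = solve-∀

  odd⇒≡1 : ∀ a → ¬ (+ 2 ∣ a) → a ≡ 1ℤ mod 2
  odd⇒≡1 a a-odd with a %ℕ 2 | n%ℕd<d a 2 | ≡-%ℕ {2} a
  ... | 0           | _                  | a≡0 = ⊥-elim (a-odd (subst (_ ∣_) (ℤ.+-identityʳ a) (divides-difference a≡0)))
  ... | 1           | _                  | a≡1 = a≡1
  ... | suc (suc _) | ℕ.s≤s (ℕ.s≤s ()) | _

  odd-odd-∣- : ∀ {a b} → ¬ (+ 2 ∣ a) → ¬ (+ 2 ∣ b) → + 2 ∣ a - b
  odd-odd-∣- {a} {b} a-odd b-odd = divides-difference (≡-trans (odd⇒≡1 a a-odd) (≡-sym (odd⇒≡1 b b-odd)))

  odd-neg : ∀ {a} → ¬ (+ 2 ∣ a) → ¬ (+ 2 ∣ - a)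
  odd-neg {a} a-odd 2∣-a = a-odd (subst (_ ∣_) (ℤ.neg-involutive a) (∣m⇒∣-m 2∣-a))

  odd-odd-∣+ : ∀ {a b} → ¬ (+ 2 ∣ a) → ¬ (+ 2 ∣ b) → + 2 ∣ a + b
  odd-odd-∣+ {a} {b} a-odd b-odd = subst (λ t → + 2 ∣ a + t) (ℤ.neg-involutive b) (odd-odd-∣- a-odd (odd-neg b-odd))

  odd+even : ∀ {a b} → ¬ (+ 2 ∣ a) → + 2 ∣ b → ¬ (+ 2 ∣ a + b)
  odd+even a-odd 2∣b 2∣a+b = a-odd (∣m+n∣n⇒∣m 2∣a+b 2∣b)

  coprime⇒∤ : ∀ a {m d} → Coprime a (+ m) → d ℕ.∣ m → d ≢ 1 → ¬ (+ d ∣ a)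
  coprime⇒∤ a a⊥m d∣m d≢1 d∣a = d≢1 (a⊥m (∣⇒∣ᵤ d∣a , d∣m))

  coprime-respects-≡-mod : ∀ {a b m} → a ≡ b mod m → Coprime a (+ m) → Coprime b (+ m)
  coprime-respects-≡-mod a≡b a⊥m (i∣b , i∣m) =
    a⊥m (∣⇒∣ᵤ (∣-respects-≡-mod (≡-sym (≡-mod-∣ i∣m a≡b)) (∣ᵤ⇒∣ i∣b)) , i∣m)

  *-cancelˡ-≡-mod : ∀ {p} → Prime p → ∀ {c x y} → ¬ (+ p ∣ c) → c * x ≡ c * y mod p → x ≡ y mod p
  *-cancelˡ-≡-mod p-prime {c} {x} {y} p∤c (congruent p∣cx-cy)
    with euclidsLemmaℤ p-prime c (x - y) (subst (_ ∣_) (distrib c x y) p∣cx-cy)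
    where
    distrib : ∀ c x y → c * x - c * y ≡ c * (x - y)
    distrib = solve-∀
  ... | inj₁ p∣c   = ⊥-elim (p∤c p∣c)
  ... | inj₂ p∣x-y = congruent p∣x-y

_⊆_ : {A : Set} → (A → Set) → (A → Set) → Set
P ⊆ Q = ∀ x → P x → Q x

⊆-antisym : ∀ {p} .{{_ : NonZero p}} {P Q : Fin p → Set} → P ⊆ Q → Q ⊆ P → _≐_ p P Q
⊆-antisym P⊆Q Q⊆P x = P⊆Q x , Q⊆P x

prime∤⇒coprime : ∀ {q k} → Prime q → ¬ q ℕ.∣ k → ℕ.Coprime k q
prime∤⇒coprime q-prime q∤k (i∣k , i∣q) with prime⇒irreducible q-prime i∣q
... | inj₁ i≡1 = i≡1
... | inj₂ refl = ⊥-elim (q∤k i∣k)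

coprime-*ʳ : ∀ {k a b} → ℕ.Coprime k a → ℕ.Coprime k b → ℕ.Coprime k (a ℕ.* b)
coprime-*ʳ {k} {a} k⊥a k⊥b (i∣k , i∣ab) = k⊥b (i∣k , ℕ.coprime-divisor i⊥a i∣ab)
  where
  i⊥a : ℕ.Coprime _ a
  i⊥a (j∣i , j∣a) = k⊥a (ℕ.∣-trans j∣i i∣k , j∣a)

coprime-^ʳ : ∀ {k a} → ℕ.Coprime k a → ∀ j → ℕ.Coprime k (a ℕ.^ j)
coprime-^ʳ k⊥a zero    (_ , i∣1) = ℕ.∣1⇒≡1 i∣1
coprime-^ʳ k⊥a (suc j) = coprime-*ʳ k⊥a (coprime-^ʳ k⊥a j)

∣-^ : ∀ q {j} → 1 ℕ.≤ j → q ℕ.∣ q ℕ.^ j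
∣-^ q {suc j} _ = ℕ.m∣m*n (q ℕ.^ j)

module Twist (q₁ q₂ : ℕ) where
  open import Data.Integer.Base using (_+_; _-_; -_; _*_)
  open CommutativeSemigroupProperties Signₚ.*-commutativeSemigroup using (interchange)

  infix 4 _∼[_]_

  _∼[_]_ : ℤ → Sign → ℤ → Set
  x ∼[ t ] y = ∃[ s ] (x ≡ s ∙ y mod q₁ × x ≡ (s Sign.* t) ∙ y mod q₂)

  ∼-sym : ∀ {t x y} → x ∼[ t ] y → y ∼[ t ] x
  ∼-sym {t} {y = y} (s , x≡₁sy , x≡₂sty) = s , ∙-sym s y x≡₁sy , ∙-sym (s Sign.* t) y x≡₂sty

  ∼-trans : ∀ {t t′ x y z} → x ∼[ t ] y → y ∼[ t′ ] z → x ∼[ t Sign.* t′ ] z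
  ∼-trans {t} {t′} {x} {z = z} (s , x≡₁ , x≡₂) (s′ , y≡₁ , y≡₂) = s Sign.* s′ , ∙-trans s s′ z x≡₁ y≡₁ ,
    subst (λ σ → x ≡ σ ∙ z mod q₂) (interchange s t s′ t′) (∙-trans (s Sign.* t) (s′ Sign.* t′) z x≡₂ y≡₂)

  ∼-*ˡ : ∀ c {t x y} → x ∼[ t ] y → c * x ∼[ t ] c * y
  ∼-*ˡ c {t} {y = y} (s , x≡₁ , x≡₂) = s ,
    ≡-trans (*-congˡ c x≡₁) (≡-reflexive (*-∙ c s y)) ,
    ≡-trans (*-congˡ c x≡₂) (≡-reflexive (*-∙ c (s Sign.* t) y))

  ∼-∤₁ : ∀ {t x y} → x ∼[ t ] y → ¬ (+ q₁ ∣ y) → ¬ (+ q₁ ∣ x)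
  ∼-∤₁ {y = y} (s , x≡₁ , _) = ∙-∤ s y x≡₁

  ∼-∤₂ : ∀ {t x y} → x ∼[ t ] y → ¬ (+ q₂ ∣ y) → ¬ (+ q₂ ∣ x)
  ∼-∤₂ {t} {y = y} (s , _ , x≡₂) = ∙-∤ (s Sign.* t) y x≡₂

  twisted⇔ : ∀ {x y} → ¬ (+ q₁ ∣ + 2 * y) → ¬ (+ q₂ ∣ + 2 * y) →
             x ∼[ Sign.- ] y ⇔ ((x ≡ - y mod q₁ ⊎ x ≡ - y mod q₂) × (x ≡ y mod q₁ ⊎ x ≡ y mod q₂))
  twisted⇔ {x} {y} q₁∤2y q₂∤2y = mk⇔ to from
    where
    to : x ∼[ Sign.- ] y → (x ≡ - y mod q₁ ⊎ x ≡ - y mod q₂) × (x ≡ y mod q₁ ⊎ x ≡ y mod q₂)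
    to (Sign.+ , x≡₁y , x≡₂-y) = inj₂ x≡₂-y , inj₁ x≡₁y
    to (Sign.- , x≡₁-y , x≡₂y) = inj₁ x≡₁-y , inj₂ x≡₂y
    from : (x ≡ - y mod q₁ ⊎ x ≡ - y mod q₂) × (x ≡ y mod q₁ ⊎ x ≡ y mod q₂) → x ∼[ Sign.- ] y
    from (inj₁ x≡₁-y , inj₂ x≡₂y) = Sign.- , x≡₁-y , x≡₂y
    from (inj₂ x≡₂-y , inj₁ x≡₁y) = Sign.+ , x≡₁y , x≡₂-y
    from (inj₁ x≡₁-y , inj₁ x≡₁y) = ⊥-elim (q₁∤2y (≡-±⇒∣2* x≡₁y x≡₁-y))
    from (inj₂ x≡₂-y , inj₂ x≡₂y) = ⊥-elim (q₂∤2y (≡-±⇒∣2* x≡₂y x≡₂-y))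

module PowersModPrime {n : ℕ} (p-prime : Prime (suc n)) where
  open import Data.Nat.Base using (_+_; _*_; _^_; _∸_; _<_; _≤_)
  open import Data.Nat.DivMod using (_%_; _/_; m%n<n; %-distribˡ-*; m%n%n≡m%n; m<n⇒m%n≡m; m≡m%n+[m/n]*n)

  p : ℕ
  p = suc n

  1<p : 1 < p
  1<p = ℕ.nonTrivial⇒n>1 p {{prime⇒nonTrivial p-prime}}

  instance
    n≢0 : NonZero n
    n≢0 = ℕ.>-nonZero (ℕ.s<s⁻¹ 1<p)

  1%p≡1 : 1 % p ≡ 1
  1%p≡1 = m<n⇒m%n≡m 1<p

  unit-indivisible : ∀ {x} → Unit p x → ¬ p ℕ.∣ toℕ x
  unit-indivisible {x} x≢0 p∣x = ℕ.<⇒≱ (Fin.toℕ<n x) (ℕ.∣⇒≤ {{ℕ.≢-nonZero x≢0}} p∣x)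

  pow-indivisible : ∀ {x} → Unit p x → ∀ k → ¬ p ℕ.∣ toℕ x ^ k
  pow-indivisible x≢0 zero    p∣1 = ¬prime[1] (subst Prime (ℕ.∣1⇒≡1 p∣1) p-prime)
  pow-indivisible x≢0 (suc k) p∣xxᵏ with euclidsLemma _ _ p-prime p∣xxᵏ
  ... | inj₁ p∣x  = unit-indivisible x≢0 p∣x
  ... | inj₂ p∣xᵏ = pow-indivisible x≢0 k p∣xᵏ

  pow-unit : ∀ {x} → Unit p x → ∀ k → toℕ x ^ k % p ≢ 0
  pow-unit x≢0 k xᵏ%p≡0 = pow-indivisible x≢0 k (ℕ.m%n≡0⇒n∣m _ p xᵏ%p≡0)

  pow-cancelˡ : ∀ {x} → Unit p x → ∀ k {y z} → (toℕ x ^ k * y) % p ≡ (toℕ x ^ k * z) % p → y % p ≡ z % p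
  pow-cancelˡ {x} x≢0 k {y} {z} eq = %ℕ-cong (*-cancelˡ-≡-mod p-prime p∤xᵏ
    (subst₂ (λ s t → s ≡ t mod p) (ℤ.pos-* (toℕ x ^ k) y) (ℤ.pos-* (toℕ x ^ k) z) (%≡%⇒≡-mod eq)))
    where
    p∤xᵏ : ¬ (+ p ∣ + (toℕ x ^ k))
    p∤xᵏ p∣xᵏ = pow-indivisible x≢0 k (∣⇒∣ᵤ p∣xᵏ)

  pow-gap : ∀ {x} → Unit p x → ∀ {k l} → k ≤ l → toℕ x ^ k % p ≡ toℕ x ^ l % p → toℕ x ^ (l ∸ k) % p ≡ 1
  pow-gap {x} x≢0 {k} {l} k≤l xᵏ≡xˡ = sym (trans (sym 1%p≡1) (pow-cancelˡ x≢0 k (begin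
    (toℕ x ^ k * 1) % p                 ≡⟨ cong (_% p) (ℕ.*-identityʳ (toℕ x ^ k)) ⟩
    toℕ x ^ k % p                       ≡⟨ xᵏ≡xˡ ⟩
    toℕ x ^ l % p                       ≡⟨ cong (λ e → toℕ x ^ e % p) (ℕ.m+[n∸m]≡n k≤l) ⟨
    toℕ x ^ (k + (l ∸ k)) % p           ≡⟨ cong (_% p) (ℕ.^-distribˡ-+-* (toℕ x) k (l ∸ k)) ⟩
    (toℕ x ^ k * toℕ x ^ (l ∸ k)) % p   ∎)))
    where open ≡-Reasoning

  power : Fin p → ℕ → Fin p
  power x k = fromℕ< (m%n<n (toℕ x ^ k) p)

  toℕ-power : ∀ x k → toℕ (power x k) ≡ toℕ x ^ k % p
  toℕ-power x k = Fin.toℕ-fromℕ< _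

  pow-% : ∀ b k → (b % p) ^ k % p ≡ b ^ k % p
  pow-% b zero    = refl
  pow-% b (suc k) = begin
    (b % p * (b % p) ^ k) % p            ≡⟨ %-distribˡ-* (b % p) ((b % p) ^ k) p ⟩
    (b % p % p * ((b % p) ^ k % p)) % p  ≡⟨ cong₂ (λ s t → (s * t) % p) (m%n%n≡m%n b p) (pow-% b k) ⟩
    (b % p * (b ^ k % p)) % p            ≡⟨ %-distribˡ-* b (b ^ k) p ⟨
    (b * b ^ k) % p                      ∎
    where open ≡-Reasoning

  *-%-identityʳ : ∀ a {b} → b % p ≡ 1 → (a * b) % p ≡ a % p
  *-%-identityʳ a {b} b≡1 = begin
    (a * b) % p              ≡⟨ %-distribˡ-* a b p ⟩
    (a % p * (b % p)) % p    ≡⟨ cong (λ t → (a % p * t) % p) b≡1 ⟩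
    (a % p * 1) % p          ≡⟨ cong (_% p) (ℕ.*-identityʳ (a % p)) ⟩
    a % p % p                ≡⟨ m%n%n≡m%n a p ⟩
    a % p                    ∎
    where open ≡-Reasoning

  pow-periodic : ∀ {b d} .{{_ : NonZero d}} → b ^ d % p ≡ 1 → ∀ k → b ^ k % p ≡ b ^ (k % d) % p
  pow-periodic {b} {d} bᵈ≡1 k = begin
    b ^ k % p                                ≡⟨ cong (λ e → b ^ e % p) (m≡m%n+[m/n]*n k d) ⟩
    b ^ (k % d + k / d * d) % p              ≡⟨ cong (_% p) (ℕ.^-distribˡ-+-* b (k % d) (k / d * d)) ⟩
    (b ^ (k % d) * b ^ (k / d * d)) % p      ≡⟨ *-%-identityʳ (b ^ (k % d)) bᵈᵐ≡1 ⟩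
    b ^ (k % d) % p                          ∎
    where
    open ≡-Reasoning
    bᵈᵐ≡1 : b ^ (k / d * d) % p ≡ 1
    bᵈᵐ≡1 = begin
      b ^ (k / d * d) % p          ≡⟨ cong (λ e → b ^ e % p) (ℕ.*-comm (k / d) d) ⟩
      b ^ (d * (k / d)) % p        ≡⟨ cong (_% p) (ℕ.^-*-assoc b d (k / d)) ⟨
      (b ^ d) ^ (k / d) % p        ≡⟨ pow-% (b ^ d) (k / d) ⟨
      (b ^ d % p) ^ (k / d) % p    ≡⟨ cong (λ t → t ^ (k / d) % p) bᵈ≡1 ⟩
      1 ^ (k / d) % p              ≡⟨ cong (_% p) (ℕ.^-zeroˡ (k / d)) ⟩
      1 % p                        ≡⟨ 1%p≡1 ⟩
      1                            ∎

  power≢0 : ∀ {x} → Unit p x → ∀ k → Fin.zero ≢ power x k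
  power≢0 {x} x≢0 k 0≡xᵏ = pow-unit x≢0 k (trans (sym (toℕ-power x k)) (cong toℕ (sym 0≡xᵏ)))

  -- Pigeonhole: two of the powers x⁰, …, xⁿ agree among the n nonzero residues.
  ∃-pow≡1 : ∀ {x} → Unit p x → ∃[ d ] (0 < d × d ≤ n × toℕ x ^ d % p ≡ 1)
  ∃-pow≡1 {x} x≢0 with Fin.pigeonhole (ℕ.n<1+n n) (λ k → Fin.punchOut (power≢0 x≢0 (toℕ k)))
  ... | i , j , i<j , eq = toℕ j ∸ toℕ i , ℕ.m<n⇒0<n∸m i<j ,
    ℕ.≤-trans (ℕ.m∸n≤m (toℕ j) (toℕ i)) (ℕ.s≤s⁻¹ (Fin.toℕ<n j)) ,
    pow-gap x≢0 (ℕ.<⇒≤ i<j) (begin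
      toℕ x ^ toℕ i % p         ≡⟨ toℕ-power x (toℕ i) ⟨
      toℕ (power x (toℕ i))     ≡⟨ cong toℕ (Fin.punchOut-injective (power≢0 x≢0 (toℕ i)) (power≢0 x≢0 (toℕ j)) eq) ⟩
      toℕ (power x (toℕ j))     ≡⟨ toℕ-power x (toℕ j) ⟩
      toℕ x ^ toℕ j % p         ∎)
    where open ≡-Reasoning

  -- Pigeonhole: for d < n, two of the n units would have exponents congruent modulo d.
  generator-period≥n : ∀ {x} → IsGen p x → ∀ {d} → 0 < d → toℕ x ^ d % p ≡ 1 → n ≤ d
  generator-period≥n {x} (_ , log) {d} 0<d xᵈ≡1 = ℕ.≮⇒≥ d≮n
    where
    instance
      d≢0 : NonZero d
      d≢0 = ℕ.>-nonZero 0<d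
    exponent : Fin n → ℕ
    exponent u = proj₁ (log (Fin.suc u) (λ ()))
    residue : Fin n → Fin d
    residue u = fromℕ< (m%n<n (exponent u) d)
    residue-injective : ∀ {u v} → residue u ≡ residue v → u ≡ v
    residue-injective {u} {v} eq = Fin.suc-injective (Fin.toℕ-injective (begin
      suc (toℕ u)                         ≡⟨ proj₂ (log (Fin.suc u) (λ ())) ⟨
      toℕ x ^ exponent u % p              ≡⟨ pow-periodic xᵈ≡1 (exponent u) ⟩
      toℕ x ^ (exponent u % d) % p        ≡⟨ cong (λ e → toℕ x ^ e % p) residues-equal ⟩
      toℕ x ^ (exponent v % d) % p        ≡⟨ pow-periodic xᵈ≡1 (exponent v) ⟨
      toℕ x ^ exponent v % p              ≡⟨ proj₂ (log (Fin.suc v) (λ ())) ⟩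
      suc (toℕ v)                         ∎))
      where
      open ≡-Reasoning
      residues-equal : exponent u % d ≡ exponent v % d
      residues-equal = trans (sym (Fin.toℕ-fromℕ< _)) (trans (cong toℕ eq) (Fin.toℕ-fromℕ< _))
    d≮n : ¬ d < n
    d≮n d<n with Fin.pigeonhole d<n residue
    ... | u , v , u<v , eq = Fin.<⇒≢ u<v (residue-injective eq)

  generator^n≡1 : ∀ {x} → IsGen p x → toℕ x ^ n % p ≡ 1
  generator^n≡1 {x} x-gen = order-is-n (∃-pow≡1 (proj₁ x-gen))
    where
    order-is-n : ∃[ d ] (0 < d × d ≤ n × toℕ x ^ d % p ≡ 1) → toℕ x ^ n % p ≡ 1
    order-is-n (d , 0<d , d≤n , xᵈ≡1) =
      subst (λ e → toℕ x ^ e % p ≡ 1) (ℕ.≤-antisym d≤n (generator-period≥n x-gen 0<d xᵈ≡1)) xᵈ≡1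

  generator-no-gap : ∀ {x} → IsGen p x → ∀ {k l} → k < l → l < n → toℕ x ^ k % p ≢ toℕ x ^ l % p
  generator-no-gap x-gen {k} {l} k<l l<n xᵏ≡xˡ = ℕ.<⇒≱ (ℕ.≤-<-trans (ℕ.m∸n≤m l k) l<n)
    (generator-period≥n x-gen (ℕ.m<n⇒0<n∸m k<l) (pow-gap (proj₁ x-gen) (ℕ.<⇒≤ k<l) xᵏ≡xˡ))

  generator-pow-injective : ∀ {x} → IsGen p x → ∀ {k l} → k < n → l < n →
                            toℕ x ^ k % p ≡ toℕ x ^ l % p → k ≡ l
  generator-pow-injective x-gen {k} {l} k<n l<n xᵏ≡xˡ with ℕ.<-cmp k l
  ... | tri< k<l _ _ = ⊥-elim (generator-no-gap x-gen k<l l<n xᵏ≡xˡ)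
  ... | tri≈ _ k≡l _ = k≡l
  ... | tri> _ _ l<k = ⊥-elim (generator-no-gap x-gen l<k k<n (sym xᵏ≡xˡ))

  mul-zeroˡ : ∀ {x} y → toℕ x ≡ 0 → toℕ (mul p x y) ≡ 0
  mul-zeroˡ {x} y x≡0 = trans (Fin.toℕ-fromℕ< _) (cong (λ t → (t * toℕ y) % p) x≡0)

  mul-zeroʳ : ∀ x {y} → toℕ y ≡ 0 → toℕ (mul p x y) ≡ 0
  mul-zeroʳ x {y} y≡0 = trans (Fin.toℕ-fromℕ< _) (trans (cong (λ t → (toℕ x * t) % p) y≡0)
    (cong (_% p) (ℕ.*-zeroʳ (toℕ x))))

module Exponential {n : ℕ} (p-prime : Prime (suc n)) {γ : Fin (suc n)} (γ-gen : IsGen (suc n) γ) where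
  open import Data.Integer.Base using (_+_; _-_; -_; _*_)
  open import Data.Nat.DivMod using (_%_; m<n⇒m%n≡m; %-distribˡ-*)
  open PowersModPrime p-prime

  E : ℤ → Fin p
  E a = power γ (a %ℕ n)

  toℕ-E : ∀ k → toℕ (E (+ k)) ≡ toℕ γ ℕ.^ k % p
  toℕ-E k = trans (toℕ-power γ (k % n)) (sym (pow-periodic (generator^n≡1 γ-gen) k))

  E-cong : ∀ {a b} → a ≡ b mod n → E a ≡ E b
  E-cong a≡b = cong (power γ) (%ℕ-cong a≡b)

  E-injective : ∀ {a b} → E a ≡ E b → a ≡ b mod n
  E-injective {a} {b} Ea≡Eb = begin
    a              ≈⟨ ≡-%ℕ a ⟩
    + (a %ℕ n)     ≡⟨ cong +_ (generator-pow-injective γ-gen (n%ℕd<d a n) (n%ℕd<d b n) residues) ⟩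
    + (b %ℕ n)     ≈⟨ ≡-%ℕ b ⟨
    b              ∎
    where
    open ≡-mod-Reasoning
    residues = trans (sym (toℕ-power γ (a %ℕ n))) (trans (cong toℕ Ea≡Eb) (toℕ-power γ (b %ℕ n)))

  E-0 : toℕ (E 0ℤ) ≡ 1
  E-0 = trans (toℕ-E 0) 1%p≡1

  E-1 : E 1ℤ ≡ γ
  E-1 = Fin.toℕ-injective (trans (toℕ-E 1) (trans (cong (_% p) (ℕ.*-identityʳ (toℕ γ))) (m<n⇒m%n≡m (Fin.toℕ<n γ))))

  E-+ : ∀ a b → mul p (E a) (E b) ≡ E (a + b)
  E-+ a b = Fin.toℕ-injective (begin
    toℕ (mul p (E a) (E b))                          ≡⟨ Fin.toℕ-fromℕ< _ ⟩
    (toℕ (E a) ℕ.* toℕ (E b)) % p                    ≡⟨ cong₂ (λ s t → (s ℕ.* t) % p) (toℕ-power γ a′) (toℕ-power γ b′) ⟩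
    (toℕ γ ℕ.^ a′ % p ℕ.* (toℕ γ ℕ.^ b′ % p)) % p    ≡⟨ %-distribˡ-* (toℕ γ ℕ.^ a′) (toℕ γ ℕ.^ b′) p ⟨
    (toℕ γ ℕ.^ a′ ℕ.* toℕ γ ℕ.^ b′) % p              ≡⟨ cong (_% p) (ℕ.^-distribˡ-+-* (toℕ γ) a′ b′) ⟨
    toℕ γ ℕ.^ (a′ ℕ.+ b′) % p                        ≡⟨ toℕ-E (a′ ℕ.+ b′) ⟨
    toℕ (E (+ a′ + + b′))                            ≡⟨ cong toℕ (E-cong (+-cong (≡-sym (≡-%ℕ a)) (≡-sym (≡-%ℕ b)))) ⟩
    toℕ (E (a + b))                                  ∎)
    where
    open ≡-Reasoning
    a′ = a %ℕ n
    b′ = b %ℕ n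

  E-pow : ∀ a k → toℕ (E a) ℕ.^ k % p ≡ toℕ (E (+ k * a))
  E-pow a k = begin
    toℕ (E a) ℕ.^ k % p              ≡⟨ cong (λ t → t ℕ.^ k % p) (toℕ-power γ a′) ⟩
    (toℕ γ ℕ.^ a′ % p) ℕ.^ k % p     ≡⟨ pow-% (toℕ γ ℕ.^ a′) k ⟩
    (toℕ γ ℕ.^ a′) ℕ.^ k % p         ≡⟨ cong (_% p) (ℕ.^-*-assoc (toℕ γ) a′ k) ⟩
    toℕ γ ℕ.^ (a′ ℕ.* k) % p         ≡⟨ toℕ-E (a′ ℕ.* k) ⟨
    toℕ (E (+ (a′ ℕ.* k)))           ≡⟨ cong toℕ (E-cong a′k≡ka) ⟩
    toℕ (E (+ k * a))                ∎
    where
    open ≡-Reasoning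
    a′ = a %ℕ n
    a′k≡ka : + (a′ ℕ.* k) ≡ + k * a mod n
    a′k≡ka = ≡-mod-Reasoning.begin
      + (a′ ℕ.* k)   ≡-mod-Reasoning.≡⟨ trans (ℤ.pos-* a′ k) (ℤ.*-comm (+ a′) (+ k)) ⟩
      + k * + a′     ≡-mod-Reasoning.≈⟨ *-congˡ (+ k) (≡-%ℕ a) ⟨
      + k * a        ≡-mod-Reasoning.∎

  E-unit : ∀ a → Unit p (E a)
  E-unit a Ea≡0 = pow-unit (proj₁ γ-gen) (a %ℕ n) (trans (sym (toℕ-power γ (a %ℕ n))) Ea≡0)

  E-surjective : ∀ {x} → Unit p x → ∃[ a ] x ≡ E a
  E-surjective {x} x≢0 = let k , γᵏ≡x = proj₂ γ-gen x x≢0 in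
    + k , Fin.toℕ-injective (trans (sym γᵏ≡x) (sym (toℕ-E k)))

  E-elim : (P : Fin p → Set) → (∀ a → P (E a)) → ∀ {x} → Unit p x → P x
  E-elim P P-E x≢0 = let a , x≡Ea = E-surjective x≢0 in subst P (sym x≡Ea) (P-E a)

  E-elim₂ : (P : Fin p → Fin p → Set) → (∀ a b → P (E a) (E b)) → ∀ {x y} → Unit p x → Unit p y → P x y
  E-elim₂ P P-E {y = y} x≢0 y≢0 = E-elim (λ x → P x y) (λ a → E-elim (P (E a)) (P-E a) y≢0) x≢0

  E-pow-cofactor≡1 : ∀ a {i t} → n ≡ t ℕ.* i → i ℕ.∣ ℤ.∣ a ∣ → toℕ (E a) ℕ.^ t % p ≡ 1
  E-pow-cofactor≡1 a {i} {t} n≡ti i∣a = trans (E-pow a t) (trans (cong toℕ (E-cong ta≡0)) E-0)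
    where
    reorder : ∀ t q i → t * (q * i) ≡ q * (t * i)
    reorder = solve-∀
    ta≡0 : + t * a ≡ 0ℤ mod n
    ta≡0 = let divides q a≡qi = ∣ᵤ⇒∣ {+ i} i∣a in congruent (divides q (begin
      + t * a - 0ℤ        ≡⟨ ℤ.+-identityʳ (+ t * a) ⟩
      + t * a             ≡⟨ cong (+ t *_) a≡qi ⟩
      + t * (q * + i)     ≡⟨ reorder (+ t) q (+ i) ⟩
      q * (+ t * + i)     ≡⟨ cong (q *_) (trans (cong +_ n≡ti) (ℤ.pos-* t i)) ⟨
      q * + n             ∎))
      where open ≡-Reasoning

  E-isGen⇒coprime : ∀ a → IsGen p (E a) → Coprime a (+ n)
  E-isGen⇒coprime a Ea-gen {i} (i∣a , ℕ.divides t n≡ti) with i ℕ.≟ 1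
  ... | yes i≡1 = i≡1
  ... | no  i≢1 =
    ⊥-elim (ℕ.<⇒≱ t<n (generator-period≥n {E a} Ea-gen (ℕ.>-nonZero⁻¹ t {{t≢0}}) (E-pow-cofactor≡1 a {i} {t} n≡ti i∣a)))
    where
    t≢0 : NonZero t
    t≢0 = ℕ.m*n≢0⇒m≢0 t {{subst NonZero n≡ti n≢0}}
    1<i : ∀ {i} → i ≢ 1 → n ≡ t ℕ.* i → 1 ℕ.< i
    1<i {zero}        _   n≡t0 = ⊥-elim (ℕ.≢-nonZero⁻¹ n (trans n≡t0 (ℕ.*-zeroʳ t)))
    1<i {suc zero}    i≢1 _    = ⊥-elim (i≢1 refl)
    1<i {suc (suc _)} _   _    = ℕ.s≤s (ℕ.s≤s ℕ.z≤n)
    t<n : t ℕ.< n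
    t<n = subst (t ℕ.<_) (sym n≡ti) (ℕ.m<m*n t i {{t≢0}} (1<i i≢1 n≡ti))

  coprime⇒E-isGen : ∀ a → Coprime a (+ n) → IsGen p (E a)
  coprime⇒E-isGen a a⊥n = E-unit a , λ y y≢0 → E-elim (λ y → ∃[ k ] toℕ (E a) ℕ.^ k % p ≡ toℕ y) reach y≢0
    where
    s = proj₁ (invertible-mod a a⊥n)
    reach : ∀ b → ∃[ k ] toℕ (E a) ℕ.^ k % p ≡ toℕ (E b)
    reach b = k , trans (E-pow a k) (cong toℕ (E-cong ka≡b))
      where
      k = (s * b) %ℕ n
      open ≡-mod-Reasoning
      ka≡b : + k * a ≡ b mod n
      ka≡b = begin
        + k * a          ≡⟨ ℤ.*-comm (+ k) a ⟩
        a * + k          ≈⟨ *-congˡ a (≡-%ℕ (s * b)) ⟨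
        a * (s * b)      ≡⟨ reorder a s b ⟩
        b * (s * a)      ≈⟨ *-congˡ b (proj₂ (invertible-mod a a⊥n)) ⟩
        b * 1ℤ           ≡⟨ ℤ.*-identityʳ b ⟩
        b                ∎
        where
        reorder : ∀ a s b → a * (s * b) ≡ b * (s * a)
        reorder = solve-∀

  E-isGen⇔coprime : ∀ a → IsGen p (E a) ⇔ Coprime a (+ n)
  E-isGen⇔coprime a = mk⇔ (E-isGen⇒coprime a) (coprime⇒E-isGen a)

  E-inverse : ∀ a → IsInv p (E a) (E (- a))
  E-inverse a = trans (cong toℕ (trans (E-+ a (- a)) (cong E (ℤ.+-inverseʳ a)))) E-0

  E-inverse-unique : ∀ a {y} → IsInv p (E a) y → y ≡ E (- a)
  E-inverse-unique a {y} inv = E-elim (λ y → IsInv p (E a) y → y ≡ E (- a)) unique y≢0 inv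
    where
    y≢0 : Unit p y
    y≢0 y≡0 with () ← trans (sym inv) (mul-zeroʳ (E a) y≡0)
    unique : ∀ b → IsInv p (E a) (E b) → E b ≡ E (- a)
    unique b Ea·Eb≡1 = E-cong (begin
      b              ≡⟨ cancel a b ⟩
      a + b - a      ≈⟨ +-cong a+b≡0 ≡-refl ⟩
      0ℤ - a         ≡⟨ ℤ.+-identityˡ (- a) ⟩
      - a            ∎)
      where
      open ≡-mod-Reasoning
      cancel : ∀ a b → b ≡ a + b - a
      cancel = solve-∀
      a+b≡0 : a + b ≡ 0ℤ mod n
      a+b≡0 = E-injective (Fin.toℕ-injective (trans (cong toℕ (sym (E-+ a b))) (trans Ea·Eb≡1 (sym E-0))))

  ∃-inverse⇔ : ∀ a (P : Fin p → Set) → (∃[ y ] (IsInv p (E a) y × P y)) ⇔ P (E (- a))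
  ∃-inverse⇔ a P = mk⇔ to from
    where
    to : ∃[ y ] (IsInv p (E a) y × P y) → P (E (- a))
    to (y , inv , Py) = subst P (E-inverse-unique a inv) Py
    from : P (E (- a)) → ∃[ y ] (IsInv p (E a) y × P y)
    from P-a = E (- a) , E-inverse a , P-a

module Characterisations {n : ℕ} (p-prime : Prime (suc n)) (2∣n : 2 ℕ.∣ n) {γ : Fin (suc n)} (γ-gen : IsGen (suc n) γ) where
  open import Data.Integer.Base using (_+_; _-_; -_; _*_)
  open PowersModPrime p-prime using (p; mul-zeroˡ)
  open Exponential p-prime γ-gen

  E-isQR⇔even : ∀ a → IsQR p (E a) ⇔ + 2 ∣ a
  E-isQR⇔even a = mk⇔ root square
    where
    double : ∀ s → s + s ≡ s * + 2
    double = solve-∀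
    even : ∀ s → mul p (E s) (E s) ≡ E a → + 2 ∣ a
    even s Es²≡Ea = ∣-respects-≡-mod (≡-mod-∣ 2∣n (E-injective (trans (sym (E-+ s s)) Es²≡Ea)))
                                     (divides s (double s))
    root : IsQR p (E a) → + 2 ∣ a
    root (_ , x , x²≡Ea) = E-elim (λ x → mul p x x ≡ E a → + 2 ∣ a) even x≢0 x²≡Ea
      where
      x≢0 : Unit p x
      x≢0 x≡0 = E-unit a (trans (cong toℕ (sym x²≡Ea)) (mul-zeroˡ x x≡0))
    square : + 2 ∣ a → IsQR p (E a)
    square (divides s a≡2s) = E-unit a , E s , trans (E-+ s s) (cong E (trans (double s) (sym a≡2s)))

  E-isNG⇔ : ∀ a → IsNG p (E a) ⇔ (¬ (+ 2 ∣ a) × ¬ Coprime a (+ n))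
  E-isNG⇔ a = mk⇔ to from
    where
    to : IsNG p (E a) → ¬ (+ 2 ∣ a) × ¬ Coprime a (+ n)
    to (_ , ¬qr , ¬gen) = (λ 2∣a → ¬qr (Equivalence.from (E-isQR⇔even a) 2∣a)) ,
                          (λ a⊥n → ¬gen (Equivalence.from (E-isGen⇔coprime a) a⊥n))
    from : ¬ (+ 2 ∣ a) × ¬ Coprime a (+ n) → IsNG p (E a)
    from (a-odd , ¬a⊥n) = E-unit a , (λ qr → a-odd (Equivalence.to (E-isQR⇔even a) qr)) ,
                                     (λ gen → ¬a⊥n (Equivalence.to (E-isGen⇔coprime a) gen))

  -- I p and NI p are Rboth (IsGen p) and Rboth (IsNG p), definitionally.
  Rboth : (Fin p → Set) → Fin p → Fin p → Set
  Rboth P g r = (IsQR p r × P (mul p g r)) × ∃[ y ] (IsInv p g y × (IsQR p r × P (mul p y r)))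

  Rboth-E⇔ : ∀ (P : Fin p → Set) u e → Rboth P (E u) (E e) ⇔ (+ 2 ∣ e × P (E (u + e)) × P (E (- u + e)))
  Rboth-E⇔ P u e = mk⇔ to from
    where
    Q : Fin p → Set
    Q y = IsQR p (E e) × P (mul p y (E e))
    to : Rboth P (E u) (E e) → + 2 ∣ e × P (E (u + e)) × P (E (- u + e))
    to ((qr , P₁) , inverse-part) = Equivalence.to (E-isQR⇔even e) qr , subst P (E-+ u e) P₁ ,
      subst P (E-+ (- u) e) (proj₂ (Equivalence.to (∃-inverse⇔ u Q) inverse-part))
    from : + 2 ∣ e × P (E (u + e)) × P (E (- u + e)) → Rboth P (E u) (E e)
    from (2∣e , P₁ , P₂) = (qr , subst P (sym (E-+ u e)) P₁) ,
      Equivalence.from (∃-inverse⇔ u Q) (qr , subst P (sym (E-+ (- u) e)) P₂)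
      where qr = Equivalence.from (E-isQR⇔even e) 2∣e

  I-E⇔ : ∀ u e → I p (E u) (E e) ⇔ (+ 2 ∣ e × Coprime (u + e) (+ n) × Coprime (- u + e) (+ n))
  I-E⇔ u e = (⇔-id _ ×-⇔ E-isGen⇔coprime (u + e) ×-⇔ E-isGen⇔coprime (- u + e)) ⇔-∘ Rboth-E⇔ (IsGen p) u e

  NI-E⇔ : ∀ {u} e → ¬ (+ 2 ∣ u) →
          NI p (E u) (E e) ⇔ (+ 2 ∣ e × ¬ Coprime (u + e) (+ n) × ¬ Coprime (- u + e) (+ n))
  NI-E⇔ {u} e u-odd = mk⇔ to from
    where
    to : NI p (E u) (E e) → + 2 ∣ e × ¬ Coprime (u + e) (+ n) × ¬ Coprime (- u + e) (+ n)
    to ni = let 2∣e , ng₁ , ng₂ = Equivalence.to (Rboth-E⇔ (IsNG p) u e) ni in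
      2∣e , proj₂ (Equivalence.to (E-isNG⇔ (u + e)) ng₁) , proj₂ (Equivalence.to (E-isNG⇔ (- u + e)) ng₂)
    from : + 2 ∣ e × ¬ Coprime (u + e) (+ n) × ¬ Coprime (- u + e) (+ n) → NI p (E u) (E e)
    from (2∣e , ¬c₁ , ¬c₂) = Equivalence.from (Rboth-E⇔ (IsNG p) u e)
      (2∣e , Equivalence.from (E-isNG⇔ (u + e)) (odd+even u-odd 2∣e , ¬c₁)
           , Equivalence.from (E-isNG⇔ (- u + e)) (odd+even (odd-neg u-odd) 2∣e , ¬c₂))

  private
    u+[v-u]≡v : ∀ u v → u + (v - u) ≡ v
    u+[v-u]≡v = solve-∀
    -u+[v+u]≡v : ∀ u v → - u + (v + u) ≡ v
    -u+[v+u]≡v = solve-∀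
    v-2u≡-u+[v-u] : ∀ u v → v - + 2 * u ≡ - u + (v - u)
    v-2u≡-u+[v-u] = solve-∀
    v+2u≡u+[v+u] : ∀ u v → v + + 2 * u ≡ u + (v + u)
    v+2u≡u+[v+u] = solve-∀
    -u+e≡u+e-2u : ∀ u e → - u + e ≡ u + e - + 2 * u
    -u+e≡u+e-2u = solve-∀
    u+e≡-u+e+2u : ∀ u e → u + e ≡ - u + e + + 2 * u
    u+e≡-u+e+2u = solve-∀

  -- M p g x is, by definition, IsGen p x × ¬ Excluded g x.
  Excluded : Fin p → Fin p → Set
  Excluded g x = ∃[ r ] (I p g r × (x ≡ mul p g r ⊎ ∃[ y ] (IsInv p g y × x ≡ mul p y r)))

  Excluded-E⇔ : ∀ u v → Coprime u (+ n) → Coprime v (+ n) →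
                Excluded (E u) (E v) ⇔ (Coprime (v - + 2 * u) (+ n) ⊎ Coprime (v + + 2 * u) (+ n))
  Excluded-E⇔ u v u⊥n v⊥n = mk⇔ to from
    where
    Cop : ℤ → Set
    Cop a = Coprime a (+ n)
    u-odd = coprime⇒∤ u u⊥n 2∣n (λ ())
    v-odd = coprime⇒∤ v v⊥n 2∣n (λ ())
    open ≡-mod-Reasoning
    Via : Fin p → Set
    Via r = I p (E u) r × (E v ≡ mul p (E u) r ⊎ ∃[ y ] (IsInv p (E u) y × E v ≡ mul p y r))
    to-E : ∀ e → Via (E e) → Cop (v - + 2 * u) ⊎ Cop (v + + 2 * u)
    to-E e (i , inj₁ Ev≡Eu·Ee) = inj₁ (coprime-respects-≡-mod (begin
      - u + e           ≡⟨ -u+e≡u+e-2u u e ⟩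
      u + e - + 2 * u   ≈⟨ +-cong (E-injective {v} {u + e} (trans Ev≡Eu·Ee (E-+ u e))) ≡-refl ⟨
      v - + 2 * u       ∎) (proj₂ (proj₂ (Equivalence.to (I-E⇔ u e) i))))
    to-E e (i , inj₂ (y , inv , Ev≡y·Ee)) = inj₂ (coprime-respects-≡-mod (begin
      u + e             ≡⟨ u+e≡-u+e+2u u e ⟩
      - u + e + + 2 * u ≈⟨ +-cong v≡-u+e ≡-refl ⟨
      v + + 2 * u       ∎) (proj₁ (proj₂ (Equivalence.to (I-E⇔ u e) i))))
      where
      v≡-u+e : v ≡ - u + e mod n
      v≡-u+e = E-injective (trans Ev≡y·Ee (trans (cong (λ y → mul p y (E e)) (E-inverse-unique u inv)) (E-+ (- u) e)))
    to : Excluded (E u) (E v) → Cop (v - + 2 * u) ⊎ Cop (v + + 2 * u)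
    to (r , via) = E-elim (λ r → Via r → Cop (v - + 2 * u) ⊎ Cop (v + + 2 * u)) to-E (proj₁ (proj₁ (proj₁ (proj₁ via)))) via
    from : Cop (v - + 2 * u) ⊎ Cop (v + + 2 * u) → Excluded (E u) (E v)
    from (inj₁ c) = E (v - u) , Equivalence.from (I-E⇔ u (v - u))
        (odd-odd-∣- v-odd u-odd , subst Cop (sym (u+[v-u]≡v u v)) v⊥n , subst Cop (v-2u≡-u+[v-u] u v) c) ,
      inj₁ (sym (trans (E-+ u (v - u)) (cong E (u+[v-u]≡v u v))))
    from (inj₂ c) = E (v + u) , Equivalence.from (I-E⇔ u (v + u))
        (odd-odd-∣+ v-odd u-odd , subst Cop (v+2u≡u+[v+u] u v) c , subst Cop (sym (-u+[v+u]≡v u v)) v⊥n) ,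
      inj₂ (E (- u) , E-inverse u , sym (trans (E-+ (- u) (v + u)) (cong E (-u+[v+u]≡v u v))))

  M-E⇔ : ∀ u v → Coprime u (+ n) →
         M p (E u) (E v) ⇔ (Coprime v (+ n) × ¬ Coprime (v + + 2 * u) (+ n) × ¬ Coprime (v - + 2 * u) (+ n))
  M-E⇔ u v u⊥n = mk⇔ to from
    where
    to : M p (E u) (E v) → Coprime v (+ n) × ¬ Coprime (v + + 2 * u) (+ n) × ¬ Coprime (v - + 2 * u) (+ n)
    to (v-gen , ¬excl) = v⊥n , (λ c → ¬excl (Equivalence.from excl⇔ (inj₂ c))) , (λ c → ¬excl (Equivalence.from excl⇔ (inj₁ c)))
      where
      v⊥n = Equivalence.to (E-isGen⇔coprime v) v-gen
      excl⇔ = Excluded-E⇔ u v u⊥n v⊥n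
    from : Coprime v (+ n) × ¬ Coprime (v + + 2 * u) (+ n) × ¬ Coprime (v - + 2 * u) (+ n) → M p (E u) (E v)
    from (v⊥n , ¬c₊ , ¬c₋) = Equivalence.from (E-isGen⇔coprime v) v⊥n ,
      λ excl → [ ¬c₋ , ¬c₊ ]′ (Equivalence.to (Excluded-E⇔ u v u⊥n v⊥n) excl)

module ThreePrimes {n q₁ q₂ i j₁ j₂ : ℕ} (p-prime : Prime (suc n))
  (q₁-prime : Prime q₁) (q₂-prime : Prime q₂) (q₁≢q₂ : q₁ ≢ q₂)
  (q₁-odd : q₁ ℕ.% 2 ≡ 1) (q₂-odd : q₂ ℕ.% 2 ≡ 1)
  (1≤i : 1 ℕ.≤ i) (1≤j₁ : 1 ℕ.≤ j₁) (1≤j₂ : 1 ℕ.≤ j₂)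
  (n≡ : n ≡ 2 ℕ.^ i ℕ.* q₁ ℕ.^ j₁ ℕ.* q₂ ℕ.^ j₂) where

  open import Data.Integer.Base using (_+_; _-_; -_; _*_)
  open PowersModPrime p-prime using (p)
  open Twist q₁ q₂

  2∣n : 2 ℕ.∣ n
  2∣n = subst (2 ℕ.∣_) (sym n≡) (ℕ.∣m⇒∣m*n (q₂ ℕ.^ j₂) (ℕ.∣m⇒∣m*n (q₁ ℕ.^ j₁) (∣-^ 2 1≤i)))

  q₁∣n : q₁ ℕ.∣ n
  q₁∣n = subst (q₁ ℕ.∣_) (sym n≡) (ℕ.∣m⇒∣m*n (q₂ ℕ.^ j₂) (ℕ.∣n⇒∣m*n (2 ℕ.^ i) (∣-^ q₁ 1≤j₁)))

  q₂∣n : q₂ ℕ.∣ n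
  q₂∣n = subst (q₂ ℕ.∣_) (sym n≡) (ℕ.∣n⇒∣m*n (2 ℕ.^ i ℕ.* q₁ ℕ.^ j₁) (∣-^ q₂ 1≤j₂))

  prime≢1 : ∀ {q} → Prime q → q ≢ 1
  prime≢1 q-prime refl = ¬prime[1] q-prime

  odd⇒2∤ : ∀ {q} → q ℕ.% 2 ≡ 1 → ¬ 2 ℕ.∣ q
  odd⇒2∤ {q} q-odd 2∣q with () ← trans (sym q-odd) (ℕ.n∣m⇒m%n≡0 q 2 2∣q)

  odd-prime∤2 : ∀ {q} → Prime q → q ℕ.% 2 ≡ 1 → ¬ (+ q ∣ + 2)
  odd-prime∤2 q-prime q-odd q∣2 with prime⇒irreducible prime[2] (∣⇒∣ᵤ q∣2)
  ... | inj₁ q≡1 = prime≢1 q-prime q≡1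
  ... | inj₂ refl with () ← q-odd

  q₁⊥q₂ : ℕ.Coprime q₁ q₂
  q₁⊥q₂ = prime∤⇒coprime q₂-prime q₂∤q₁
    where
    q₂∤q₁ : ¬ q₂ ℕ.∣ q₁
    q₂∤q₁ q₂∣q₁ with prime⇒irreducible q₁-prime q₂∣q₁
    ... | inj₁ q₂≡1  = prime≢1 q₂-prime q₂≡1
    ... | inj₂ q₂≡q₁ = q₁≢q₂ (sym q₂≡q₁)

  2⊥q₁q₂ : ℕ.Coprime 2 (q₁ ℕ.* q₂)
  2⊥q₁q₂ = coprime-*ʳ {2} {q₁} {q₂} (ℕ.sym (prime∤⇒coprime prime[2] (odd⇒2∤ q₁-odd)))
                      (ℕ.sym (prime∤⇒coprime prime[2] (odd⇒2∤ q₂-odd)))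

  coprime-n : ∀ a → ¬ (+ 2 ∣ a) → ¬ (+ q₁ ∣ a) → ¬ (+ q₂ ∣ a) → Coprime a (+ n)
  coprime-n a 2∤a q₁∤a q₂∤a = subst (ℕ.Coprime ℤ.∣ a ∣) (sym n≡)
    (coprime-*ʳ (coprime-*ʳ (coprime-^ʳ (⊥prime prime[2] 2∤a) i) (coprime-^ʳ (⊥prime q₁-prime q₁∤a) j₁))
                (coprime-^ʳ (⊥prime q₂-prime q₂∤a) j₂))
    where
    ⊥prime : ∀ {q} → Prime q → ¬ (+ q ∣ a) → ℕ.Coprime ℤ.∣ a ∣ q
    ⊥prime q-prime q∤a = prime∤⇒coprime q-prime (λ q∣a → q∤a (∣ᵤ⇒∣ q∣a))

  ¬coprime⇔ : ∀ {a} → ¬ (+ 2 ∣ a) → (¬ Coprime a (+ n)) ⇔ (+ q₁ ∣ a ⊎ + q₂ ∣ a)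
  ¬coprime⇔ {a} 2∤a = mk⇔ to from
    where
    to : ¬ Coprime a (+ n) → + q₁ ∣ a ⊎ + q₂ ∣ a
    to ¬a⊥n with + q₁ ∣? a | + q₂ ∣? a
    ... | yes q₁∣a | _        = inj₁ q₁∣a
    ... | no  _    | yes q₂∣a = inj₂ q₂∣a
    ... | no  q₁∤a | no  q₂∤a = ⊥-elim (¬a⊥n (coprime-n a 2∤a q₁∤a q₂∤a))
    from : + q₁ ∣ a ⊎ + q₂ ∣ a → ¬ Coprime a (+ n)
    from (inj₁ q₁∣a) a⊥n = coprime⇒∤ a a⊥n q₁∣n (prime≢1 q₁-prime) q₁∣a
    from (inj₂ q₂∣a) a⊥n = coprime⇒∤ a a⊥n q₂∣n (prime≢1 q₂-prime) q₂∣a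

  odd-prime∤2* : ∀ {q a} → Prime q → q ℕ.% 2 ≡ 1 → ¬ (+ q ∣ a) → ¬ (+ q ∣ + 2 * a)
  odd-prime∤2* {q} {a} q-prime q-odd q∤a q∣2a with euclidsLemmaℤ q-prime (+ 2) a q∣2a
  ... | inj₁ q∣2 = odd-prime∤2 q-prime q-odd q∣2
  ... | inj₂ q∣a = q∤a q∣a

  twisted-with-parity : ∀ t y r → ∃[ z ] (z ≡ r mod 2 × z ∼[ t ] y)
  twisted-with-parity t y r =
    let z₀ , z₀≡₁y , z₀≡₂ty = crt q₁⊥q₂ y (t ∙ y)
        z  , z≡z₀ , z≡r     = crt (ℕ.sym 2⊥q₁q₂) z₀ r
    in z , z≡r , Sign.+ , ≡-trans (≡-mod-∣ (ℕ.m∣m*n q₂) z≡z₀) z₀≡₁y ,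
                          ≡-trans (≡-mod-∣ (ℕ.n∣m*n q₁) z≡z₀) z₀≡₂ty

  even-twisted : ∀ t y → ∃[ z ] (+ 2 ∣ z × z ∼[ t ] y)
  even-twisted t y = let z , z≡0 , z∼y = twisted-with-parity t y 0ℤ in
    z , subst (_ ∣_) (ℤ.+-identityʳ z) (divides-difference z≡0) , z∼y

  odd-twisted : ∀ t y → ∃[ z ] (¬ (+ 2 ∣ z) × z ∼[ t ] y)
  odd-twisted t y = let z , z≡1 , z∼y = twisted-with-parity t y 1ℤ in
    z , (λ 2∣z → 2∤1 (∣⇒∣ᵤ (∣-respects-≡-mod z≡1 2∣z))) , z∼y
    where
    2∤1 : ¬ 2 ℕ.∣ 1
    2∤1 2∣1 with () ← ℕ.∣1⇒≡1 2∣1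

  half : ∃[ h ] (+ 2 * h ∼[ Sign.+ ] 1ℤ)
  half = let h , h2≡1 = invertible-mod (+ 2) 2⊥q₁q₂
             2h≡1 = ≡-trans (≡-reflexive (ℤ.*-comm (+ 2) h)) h2≡1
         in h , Sign.+ , ≡-mod-∣ (ℕ.m∣m*n q₂) 2h≡1 , ≡-mod-∣ (ℕ.n∣m*n q₁) 2h≡1

  1⊥n : Coprime 1ℤ (+ n)
  1⊥n (i∣1 , _) = ℕ.∣1⇒≡1 i∣1

  NI-unit : ∀ g {x} → NI p g x → Unit p x
  NI-unit _ (((x≢0 , _) , _) , _) = x≢0

  M-unit : ∀ g {x} → M p g x → Unit p x
  M-unit _ ((x≢0 , _) , _) = x≢0

  module Classes {γ : Fin p} (γ-gen : IsGen p γ) where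
    open Exponential p-prime γ-gen
    open Characterisations p-prime 2∣n γ-gen

    coprime⇒prime∤ : ∀ {v q} → Prime q → q ℕ.∣ n → Coprime v (+ n) → ¬ (+ q ∣ v)
    coprime⇒prime∤ {v} q-prime q∣n v⊥n = coprime⇒∤ v v⊥n q∣n (prime≢1 q-prime)

    NI-spec : ∀ {v} e → Coprime v (+ n) → NI p (E v) (E e) ⇔ (+ 2 ∣ e × e ∼[ Sign.- ] v)
    NI-spec {v} e v⊥n = mk⇔ to from
      where
      v-odd = coprime⇒∤ v v⊥n 2∣n (λ ())
      twist⇔ = twisted⇔ (odd-prime∤2* q₁-prime q₁-odd (coprime⇒prime∤ q₁-prime q₁∣n v⊥n))
                        (odd-prime∤2* q₂-prime q₂-odd (coprime⇒prime∤ q₂-prime q₂∣n v⊥n))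
      v+e≡e-[-v] : v + e ≡ e - - v
      v+e≡e-[-v] = trans (ℤ.+-comm v e) (cong (_+_ e) (sym (ℤ.neg-involutive v)))
      sum⇔ : + 2 ∣ e → (¬ Coprime (v + e) (+ n)) ⇔ (e ≡ - v mod q₁ ⊎ e ≡ - v mod q₂)
      sum⇔ 2∣e = (∣⇔≡-mod v+e≡e-[-v] ⊎-⇔ ∣⇔≡-mod v+e≡e-[-v]) ⇔-∘ ¬coprime⇔ (odd+even v-odd 2∣e)
      diff⇔ : + 2 ∣ e → (¬ Coprime (- v + e) (+ n)) ⇔ (e ≡ v mod q₁ ⊎ e ≡ v mod q₂)
      diff⇔ 2∣e = (∣⇔≡-mod (ℤ.+-comm (- v) e) ⊎-⇔ ∣⇔≡-mod (ℤ.+-comm (- v) e)) ⇔-∘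
                  ¬coprime⇔ (odd+even (odd-neg v-odd) 2∣e)
      to : NI p (E v) (E e) → + 2 ∣ e × e ∼[ Sign.- ] v
      to ni = let 2∣e , ¬c₊ , ¬c₋ = Equivalence.to (NI-E⇔ e v-odd) ni in
        2∣e , Equivalence.from twist⇔ (Equivalence.to (sum⇔ 2∣e) ¬c₊ , Equivalence.to (diff⇔ 2∣e) ¬c₋)
      from : + 2 ∣ e × e ∼[ Sign.- ] v → NI p (E v) (E e)
      from (2∣e , e∼v) = let s₊ , s₋ = Equivalence.to twist⇔ e∼v in
        Equivalence.from (NI-E⇔ e v-odd) (2∣e , Equivalence.from (sum⇔ 2∣e) s₊ , Equivalence.from (diff⇔ 2∣e) s₋)

    M-spec : ∀ u v → Coprime u (+ n) → M p (E u) (E v) ⇔ (¬ (+ 2 ∣ v) × v ∼[ Sign.- ] + 2 * u)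
    M-spec u v u⊥n = mk⇔ to from
      where
      q₁∤2u = odd-prime∤2* q₁-prime q₁-odd (coprime⇒prime∤ q₁-prime q₁∣n u⊥n)
      q₂∤2u = odd-prime∤2* q₂-prime q₂-odd (coprime⇒prime∤ q₂-prime q₂∣n u⊥n)
      twist⇔ = twisted⇔ (odd-prime∤2* q₁-prime q₁-odd q₁∤2u) (odd-prime∤2* q₂-prime q₂-odd q₂∤2u)
      2∣2u : + 2 ∣ + 2 * u
      2∣2u = divides u (ℤ.*-comm (+ 2) u)
      v+2u≡v-[-2u] : v + + 2 * u ≡ v - - (+ 2 * u)
      v+2u≡v-[-2u] = cong (_+_ v) (sym (ℤ.neg-involutive (+ 2 * u)))
      sum⇔ : ¬ (+ 2 ∣ v) → (¬ Coprime (v + + 2 * u) (+ n)) ⇔ (v ≡ - (+ 2 * u) mod q₁ ⊎ v ≡ - (+ 2 * u) mod q₂)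
      sum⇔ v-odd = (∣⇔≡-mod v+2u≡v-[-2u] ⊎-⇔ ∣⇔≡-mod v+2u≡v-[-2u]) ⇔-∘ ¬coprime⇔ (odd+even v-odd 2∣2u)
      diff⇔ : ¬ (+ 2 ∣ v) → (¬ Coprime (v - + 2 * u) (+ n)) ⇔ (v ≡ + 2 * u mod q₁ ⊎ v ≡ + 2 * u mod q₂)
      diff⇔ v-odd = (∣⇔≡-mod refl ⊎-⇔ ∣⇔≡-mod refl) ⇔-∘ ¬coprime⇔ (odd+even v-odd (∣m⇒∣-m 2∣2u))
      to : M p (E u) (E v) → ¬ (+ 2 ∣ v) × v ∼[ Sign.- ] + 2 * u
      to v∈M = let v⊥n , ¬c₊ , ¬c₋ = Equivalence.to (M-E⇔ u v u⊥n) v∈M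
                   v-odd = coprime⇒∤ v v⊥n 2∣n (λ ())
               in v-odd , Equivalence.from twist⇔ (Equivalence.to (sum⇔ v-odd) ¬c₊ , Equivalence.to (diff⇔ v-odd) ¬c₋)
      from : ¬ (+ 2 ∣ v) × v ∼[ Sign.- ] + 2 * u → M p (E u) (E v)
      from (v-odd , v∼2u) = let s₊ , s₋ = Equivalence.to twist⇔ v∼2u in
        Equivalence.from (M-E⇔ u v u⊥n) (coprime-n v v-odd (∼-∤₁ v∼2u q₁∤2u) (∼-∤₂ v∼2u q₂∤2u) ,
                                         Equivalence.from (sum⇔ v-odd) s₊ , Equivalence.from (diff⇔ v-odd) s₋)

    M-class : ∀ {u v v′} → Coprime u (+ n) → M p (E u) (E v) → M p (E u) (E v′) → v ∼[ Sign.+ ] v′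
    M-class {u} {v} {v′} u⊥n v∈M v′∈M =
      ∼-trans (proj₂ (Equivalence.to (M-spec u v u⊥n) v∈M)) (∼-sym (proj₂ (Equivalence.to (M-spec u v′ u⊥n) v′∈M)))

    NI-⊆ : ∀ {v v′} → Coprime v (+ n) → Coprime v′ (+ n) → v ∼[ Sign.+ ] v′ → NI p (E v) ⊆ NI p (E v′)
    NI-⊆ {v} {v′} v⊥n v′⊥n v∼v′ x x∈NI = E-elim (λ x → NI p (E v) x → NI p (E v′) x) shift (NI-unit (E v) x∈NI) x∈NI
      where
      shift : ∀ e → NI p (E v) (E e) → NI p (E v′) (E e)
      shift e e∈NI = let 2∣e , e∼v = Equivalence.to (NI-spec e v⊥n) e∈NI in
        Equivalence.from (NI-spec e v′⊥n) (2∣e , ∼-trans e∼v v∼v′)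

    NI-⊆⇒∼ : ∀ {v v′} → Coprime v (+ n) → Coprime v′ (+ n) → NI p (E v) ⊆ NI p (E v′) → v ∼[ Sign.+ ] v′
    NI-⊆⇒∼ {v} {v′} v⊥n v′⊥n NIv⊆NIv′ =
      let e , 2∣e , e∼v = even-twisted Sign.- v
          e∈NIv′ = NIv⊆NIv′ (E e) (Equivalence.from (NI-spec e v⊥n) (2∣e , e∼v))
      in ∼-trans (∼-sym e∼v) (proj₂ (Equivalence.to (NI-spec e v′⊥n) e∈NIv′))

    M-⊆ : ∀ {u u′ v v′} → Coprime u (+ n) → Coprime u′ (+ n) →
          M p (E u) (E v) → M p (E u′) (E v′) → v ∼[ Sign.+ ] v′ → M p (E u) ⊆ M p (E u′)
    M-⊆ {u} {u′} {v} {v′} u⊥n u′⊥n v∈M v′∈M′ v∼v′ x x∈M = E-elim (λ x → M p (E u) x → M p (E u′) x) move (M-unit (E u) x∈M) x∈M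
      where
      move : ∀ z → M p (E u) (E z) → M p (E u′) (E z)
      move z z∈M = let z-odd , _ = Equivalence.to (M-spec u z u⊥n) z∈M in
        Equivalence.from (M-spec u′ z u′⊥n)
          (z-odd , ∼-trans (∼-trans (M-class {u} {z} {v} u⊥n z∈M v∈M) v∼v′) (proj₂ (Equivalence.to (M-spec u′ v′ u′⊥n) v′∈M′)))

    nonempty-E : ∀ u → Coprime u (+ n) → ∃[ v ] M p (E u) (E v)
    nonempty-E u u⊥n = let v , v-odd , v∼2u = odd-twisted Sign.- (+ 2 * u) in
      v , Equivalence.from (M-spec u v u⊥n) (v-odd , v∼2u)

    constant-E : ∀ u v v′ → Coprime u (+ n) → M p (E u) (E v) → M p (E u) (E v′) → _≐_ p (NI p (E v)) (NI p (E v′))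
    constant-E u v v′ u⊥n v∈M v′∈M = ⊆-antisym (NI-⊆ {v} {v′} v⊥n v′⊥n v∼v′) (NI-⊆ {v′} {v} v′⊥n v⊥n (∼-sym v∼v′))
      where
      v⊥n = Equivalence.to (E-isGen⇔coprime v) (proj₁ v∈M)
      v′⊥n = Equivalence.to (E-isGen⇔coprime v′) (proj₁ v′∈M)
      v∼v′ = M-class {u} {v} {v′} u⊥n v∈M v′∈M

    injective-E : ∀ u u′ v v′ → Coprime u (+ n) → Coprime u′ (+ n) → M p (E u) (E v) → M p (E u′) (E v′) →
                  _≐_ p (NI p (E v)) (NI p (E v′)) → _≐_ p (M p (E u)) (M p (E u′))
    injective-E u u′ v v′ u⊥n u′⊥n v∈M v′∈M′ NI≐ =
      ⊆-antisym (M-⊆ {u} {u′} {v} {v′} u⊥n u′⊥n v∈M v′∈M′ v∼v′) (M-⊆ {u′} {u} {v′} {v} u′⊥n u⊥n v′∈M′ v∈M (∼-sym v∼v′))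
      where
      v⊥n = Equivalence.to (E-isGen⇔coprime v) (proj₁ v∈M)
      v′⊥n = Equivalence.to (E-isGen⇔coprime v′) (proj₁ v′∈M′)
      v∼v′ = NI-⊆⇒∼ {v} {v′} v⊥n v′⊥n (λ x → proj₁ (NI≐ x))

    surjective-E : ∀ w → Coprime w (+ n) → ∃[ u ] (Coprime u (+ n) × M p (E u) (E w))
    surjective-E w w⊥n = from-witness (odd-twisted Sign.- (h * w))
      where
      h = proj₁ half
      reassoc : ∀ h w → w * (+ 2 * h) ≡ + 2 * (h * w)
      reassoc = solve-∀
      2hw∼w : + 2 * (h * w) ∼[ Sign.+ ] w
      2hw∼w = subst₂ (λ a b → a ∼[ Sign.+ ] b) (reassoc h w) (ℤ.*-identityʳ w) (∼-*ˡ w (proj₂ half))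
      from-witness : ∃[ u ] (¬ (+ 2 ∣ u) × u ∼[ Sign.- ] h * w) → ∃[ u ] (Coprime u (+ n) × M p (E u) (E w))
      from-witness (u , u-odd , u∼hw) =
        u , u⊥n , Equivalence.from (M-spec u w u⊥n) (coprime⇒∤ w w⊥n 2∣n (λ ()) , ∼-sym 2u∼w)
        where
        2u∼w : + 2 * u ∼[ Sign.- ] w
        2u∼w = ∼-trans (∼-*ˡ (+ 2) u∼hw) 2hw∼w
        q₁∤u : ¬ (+ q₁ ∣ u)
        q₁∤u q₁∣u = ∼-∤₁ 2u∼w (coprime⇒prime∤ q₁-prime q₁∣n w⊥n) (∣n⇒∣m*n (+ 2) q₁∣u)
        q₂∤u : ¬ (+ q₂ ∣ u)
        q₂∤u q₂∣u = ∼-∤₂ 2u∼w (coprime⇒prime∤ q₂-prime q₂∣n w⊥n) (∣n⇒∣m*n (+ 2) q₂∣u)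
        u⊥n = coprime-n u u-odd q₁∤u q₂∤u

    at-γ : ∀ {x} → M p (E 1ℤ) x → M p γ x
    at-γ = subst (λ g → M p g _) E-1

    from-γ : ∀ {x} → M p γ x → M p (E 1ℤ) x
    from-γ = subst (λ g → M p g _) (sym E-1)

    nonempty : ∃[ h ] M p γ h
    nonempty = let v , v∈M = nonempty-E 1ℤ 1⊥n in E v , at-γ v∈M

    constant : ∀ h h′ → M p γ h → M p γ h′ → _≐_ p (NI p h) (NI p h′)
    constant h h′ h∈M h′∈M = E-elim₂ (λ h h′ → M p γ h → M p γ h′ → _≐_ p (NI p h) (NI p h′))
      (λ v v′ v∈M v′∈M → constant-E 1ℤ v v′ 1⊥n (from-γ v∈M) (from-γ v′∈M))
      (M-unit γ h∈M) (M-unit γ h′∈M) h∈M h′∈M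

    injective : ∀ g′ → IsGen p g′ → ∀ h h′ → M p γ h → M p g′ h′ →
                _≐_ p (NI p h) (NI p h′) → _≐_ p (M p γ) (M p g′)
    injective g′ g′-gen h h′ h∈M h′∈M′ NI≐ =
      E-elim (λ g′ → IsGen p g′ → M p g′ h′ → _≐_ p (M p γ) (M p g′)) injective-at (proj₁ g′-gen) g′-gen h′∈M′
      where
      injective-at : ∀ u′ → IsGen p (E u′) → M p (E u′) h′ → _≐_ p (M p γ) (M p (E u′))
      injective-at u′ u′-gen h′∈M′ = E-elim₂
        (λ h h′ → M p γ h → M p (E u′) h′ → _≐_ p (NI p h) (NI p h′) → _≐_ p (M p γ) (M p (E u′)))
        (λ v v′ v∈M v′∈M′ NI≐ → subst (λ g → _≐_ p (M p g) (M p (E u′))) E-1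
          (injective-E 1ℤ u′ v v′ 1⊥n (Equivalence.to (E-isGen⇔coprime u′) u′-gen) (from-γ v∈M) v′∈M′ NI≐))
        (M-unit γ h∈M) (M-unit (E u′) h′∈M′) h∈M h′∈M′ NI≐

    surjective : ∃[ g′ ] (IsGen p g′ × ∃[ h ] (M p g′ h × _≐_ p (NI p h) (NI p γ)))
    surjective = let u , u⊥n , 1∈M = surjective-E 1ℤ 1⊥n in
      E u , Equivalence.from (E-isGen⇔coprime u) u⊥n , γ , subst (M p (E u)) E-1 1∈M , λ x → (λ h → h) , (λ h → h)

  -- Each field uses its own generator g as the base γ, so that g = E 1ℤ.
  bijection : fIsBijection p
  bijection = record
    { nonempty   = λ g g-gen → Classes.nonempty g-gen
    ; constant   = λ g g-gen → Classes.constant g-gen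
    ; injective  = λ g g′ g-gen → Classes.injective g-gen g′
    ; surjective = λ g g-gen → Classes.surjective g-gen
    }

open import Data.Nat using (ℕ; _*_; _^_; _∸_; _≤_; NonZero)
open import Data.Nat.DivMod using (_%_)
open import Data.Nat.Primality using (Prime)
open import Relation.Binary.PropositionalEquality using (_≡_; _≢_)

lemma9 : (p i j₁ j₂ q₁ q₂ : ℕ) .{{_ : NonZero p}} →
         Prime p → Prime q₁ → Prime q₂ → q₁ ≢ q₂ →
         q₁ % 2 ≡ 1 → q₂ % 2 ≡ 1 →
         1 ≤ i → 1 ≤ j₁ → 1 ≤ j₂ →
         p ∸ 1 ≡ 2 ^ i * q₁ ^ j₁ * q₂ ^ j₂ →
         fIsBijection p
lemma9 zero    _ _ _ _ _ p-prime = ⊥-elim (¬prime[0] p-prime)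
lemma9 (suc n) i j₁ j₂ q₁ q₂ p-prime q₁-prime q₂-prime q₁≢q₂ q₁-odd q₂-odd 1≤i 1≤j₁ 1≤j₂ n≡ =
  ThreePrimes.bijection p-prime q₁-prime q₂-prime q₁≢q₂ q₁-odd q₂-odd 1≤i 1≤j₁ 1≤j₂ n≡
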